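{- For isos $\omega,\omega'$, if $\omega\to\omega'$ then $\omega^{ -1}\to\omega'^{ -1}$.
   Context: Isos of the language: $\omega::=\{v_1\leftrightarrow e_1\mid\dots\mid v_n\leftrightarrow e_n\}\mid \mathtt{fix}\,\phi.\omega\mid\lambda\phi.\omega\mid\phi\mid\omega_1\omega_2$ ($\phi$ iso-variables), where $v_i$ are values and $e_i$ expressions $e::=v\mid\mathtt{let}\,p_1=\omega\,p_2\,\mathtt{in}\,e$ (patterns $p::=x\mid\langle p_1,p_2\rangle$). Reduction on isos: $\mathtt{fix}\,\phi.\omega\to\omega[\mathtt{fix}\,\phi.\omega/\phi]$; $(\lambda\phi.\omega_1)\omega_2\to\omega_1[\omega_2/\phi]$; $\omega_1\omega_2\to\omega_1'\omega_2$ if $\omega_1\to\omega_1'$. Inversion: $\phi^{ -1}=\phi$; $(\mathtt{fix}\,\phi.\omega)^{ -1}=\mathtt{fix}\,\phi.\omega^{ -1}$; $(\omega_1\omega_2)^{ -1}=\omega_1^{ -1}\omega_2^{ -1}$; $(\lambda\phi.\omega)^{ -1}=\lambda\phi.\omega^{ -1}$; a clause-set is inverted clause by clause, with $(v\leftrightarrow\mathtt{let}\,p_1=\omega_1\,p_1'\,\mathtt{in}\cdots\mathtt{let}\,p_n=\omega_n\,p_n'\,\mathtt{in}\,v')^{ -1}=(v'\leftrightarrow\mathtt{let}\,p_n'=\omega_n^{ -1}\,p_n\,\mathtt{in}\cdots\mathtt{let}\,p_1'=\omega_1^{ -1}\,p_1\,\mathtt{in}\,v)$. -}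

module Defs where

open import Data.Nat using (ℕ; zero; suc)
open import Data.Product using (_×_; _,_)

-- Term variables (in values / patterns) are names; iso-variables are de Bruijn indices.

data Val : Set where
  vunit : Val
  vvar  : ℕ → Val
  vinl  : Val → Val
  vinr  : Val → Val
  vpair : Val → Val → Val
  vfold : Val → Val

data Pat : Set where
  pvar  : ℕ → Pat
  ppair : Pat → Pat → Pat

mutual
  data Iso : Set where
    clauses : Clauses → Iso
    fix     : Iso → Iso
    lam     : Iso → Iso
    var     : ℕ → Iso
    app     : Iso → Iso → Iso

  -- e ::= v | let p₁ = ω p₂ in e
  data Expr : Set where
    val    : Val → Expr
    letIso : Pat → Iso → Pat → Expr → Expr

  data Clauses : Set where
    []  : Clauses
    _∷_ : Val × Expr → Clauses → Clauses

infixr 5 _∷_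

ext : (ℕ → ℕ) → ℕ → ℕ
ext ρ zero = zero
ext ρ (suc n) = suc (ρ n)

mutual
  renIso : (ℕ → ℕ) → Iso → Iso
  renIso ρ (clauses cs) = clauses (renCl ρ cs)
  renIso ρ (fix ω) = fix (renIso (ext ρ) ω)
  renIso ρ (lam ω) = lam (renIso (ext ρ) ω)
  renIso ρ (var n) = var (ρ n)
  renIso ρ (app ω₁ ω₂) = app (renIso ρ ω₁) (renIso ρ ω₂)

  renExpr : (ℕ → ℕ) → Expr → Expr
  renExpr ρ (val v) = val v
  renExpr ρ (letIso p ω p' e) = letIso p (renIso ρ ω) p' (renExpr ρ e)

  renCl : (ℕ → ℕ) → Clauses → Clauses
  renCl ρ [] = []
  renCl ρ ((v , e) ∷ cs) = (v , renExpr ρ e) ∷ renCl ρ cs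

exts : (ℕ → Iso) → ℕ → Iso
exts σ zero = var zero
exts σ (suc n) = renIso suc (σ n)

mutual
  subIso : (ℕ → Iso) → Iso → Iso
  subIso σ (clauses cs) = clauses (subCl σ cs)
  subIso σ (fix ω) = fix (subIso (exts σ) ω)
  subIso σ (lam ω) = lam (subIso (exts σ) ω)
  subIso σ (var n) = σ n
  subIso σ (app ω₁ ω₂) = app (subIso σ ω₁) (subIso σ ω₂)

  subExpr : (ℕ → Iso) → Expr → Expr
  subExpr σ (val v) = val v
  subExpr σ (letIso p ω p' e) = letIso p (subIso σ ω) p' (subExpr σ e)

  subCl : (ℕ → Iso) → Clauses → Clauses
  subCl σ [] = []
  subCl σ ((v , e) ∷ cs) = (v , subExpr σ e) ∷ subCl σ cs

-- ω [ ω' / φ ] where φ is the outermost bound variable (index 0)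
single : Iso → ℕ → Iso
single ω' zero = ω'
single ω' (suc n) = var n

_[_] : Iso → Iso → Iso
ω [ ω' ] = subIso (single ω') ω

infix 4 _⟶_
data _⟶_ : Iso → Iso → Set where
  fix-unfold : ∀ {ω} → fix ω ⟶ ω [ fix ω ]
  beta       : ∀ {ω₁ ω₂} → app (lam ω₁) ω₂ ⟶ ω₁ [ ω₂ ]
  app-left   : ∀ {ω₁ ω₁' ω₂} → ω₁ ⟶ ω₁' → app ω₁ ω₂ ⟶ app ω₁' ω₂

mutual
  inv : Iso → Iso
  inv (clauses cs) = clauses (invCl cs)
  inv (fix ω) = fix (inv ω)
  inv (lam ω) = lam (inv ω)
  inv (var n) = var n
  inv (app ω₁ ω₂) = app (inv ω₁) (inv ω₂)

  -- invClause e acc: walks the let-chain e, pushing inverted lets onto acc;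
  -- (v ↔ let p₁=ω₁ p₁' in … let pₙ=ωₙ pₙ' in v')⁻¹
  --   = (v' ↔ let pₙ'=ωₙ⁻¹ pₙ in … let p₁'=ω₁⁻¹ p₁ in v)
  invChain : Expr → Expr → Val × Expr
  invChain (val v') acc = (v' , acc)
  invChain (letIso p ω p' e) acc = invChain e (letIso p' (inv ω) p acc)

  invCl : Clauses → Clauses
  invCl [] = []
  invCl ((v , e) ∷ cs) = invChain e (val v) ∷ invCl cs

-- Inversion is a structural map on iso syntax that fixes iso-variables and only
-- reorders let-bindings, so it commutes with renaming and with substitution of
-- iso-variables, hence with ω [ ω' ]. Consequently it sends the redex and the
-- contractum of each reduction rule to the redex and contractum of the same rule.

module Submission where

open import Defs
open import Data.Nat using (ℕ; zero; suc)
open import Data.Product using (_,_; proj₁; proj₂)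
open import Relation.Binary.PropositionalEquality
  using (_≡_; refl; sym; trans; cong; cong₂; subst)

mutual
  inv-renIso : ∀ ρ ω → inv (renIso ρ ω) ≡ renIso ρ (inv ω)
  inv-renIso ρ (clauses cs)  = cong clauses (invCl-renCl ρ cs)
  inv-renIso ρ (fix ω)       = cong fix (inv-renIso (ext ρ) ω)
  inv-renIso ρ (lam ω)       = cong lam (inv-renIso (ext ρ) ω)
  inv-renIso ρ (var n)       = refl
  inv-renIso ρ (app ω₁ ω₂)   = cong₂ app (inv-renIso ρ ω₁) (inv-renIso ρ ω₂)

  invChain-renExpr : ∀ ρ e acc →
    invChain (renExpr ρ e) (renExpr ρ acc)
      ≡ (proj₁ (invChain e acc) , renExpr ρ (proj₂ (invChain e acc)))
  invChain-renExpr ρ (val v') acc = refl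
  invChain-renExpr ρ (letIso p ω p' e) acc
    rewrite inv-renIso ρ ω = invChain-renExpr ρ e (letIso p' (inv ω) p acc)

  invCl-renCl : ∀ ρ cs → invCl (renCl ρ cs) ≡ renCl ρ (invCl cs)
  invCl-renCl ρ []             = refl
  invCl-renCl ρ ((v , e) ∷ cs) =
    cong₂ _∷_ (invChain-renExpr ρ e (val v)) (invCl-renCl ρ cs)

InvertsTo : (ℕ → Iso) → (ℕ → Iso) → Set
InvertsTo σ τ = ∀ n → inv (σ n) ≡ τ n

exts-InvertsTo : ∀ {σ τ} → InvertsTo σ τ → InvertsTo (exts σ) (exts τ)
exts-InvertsTo         h zero    = refl
exts-InvertsTo {σ} {τ} h (suc n) = trans (inv-renIso suc (σ n)) (cong (renIso suc) (h n))

mutual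
  inv-subIso : ∀ {σ τ} → InvertsTo σ τ → ∀ ω → inv (subIso σ ω) ≡ subIso τ (inv ω)
  inv-subIso h (clauses cs) = cong clauses (invCl-subCl h cs)
  inv-subIso h (fix ω)      = cong fix (inv-subIso (exts-InvertsTo h) ω)
  inv-subIso h (lam ω)      = cong lam (inv-subIso (exts-InvertsTo h) ω)
  inv-subIso h (var n)      = h n
  inv-subIso h (app ω₁ ω₂)  = cong₂ app (inv-subIso h ω₁) (inv-subIso h ω₂)

  invChain-subExpr : ∀ {σ τ} → InvertsTo σ τ → ∀ e acc →
    invChain (subExpr σ e) (subExpr τ acc)
      ≡ (proj₁ (invChain e acc) , subExpr τ (proj₂ (invChain e acc)))
  invChain-subExpr h (val v') acc = refl
  invChain-subExpr h (letIso p ω p' e) acc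
    rewrite inv-subIso h ω = invChain-subExpr h e (letIso p' (inv ω) p acc)

  invCl-subCl : ∀ {σ τ} → InvertsTo σ τ → ∀ cs → invCl (subCl σ cs) ≡ subCl τ (invCl cs)
  invCl-subCl h []             = refl
  invCl-subCl h ((v , e) ∷ cs) =
    cong₂ _∷_ (invChain-subExpr h e (val v)) (invCl-subCl h cs)

single-InvertsTo : ∀ ω' → InvertsTo (single ω') (single (inv ω'))
single-InvertsTo ω' zero    = refl
single-InvertsTo ω' (suc n) = refl

inv-[] : ∀ ω ω' → inv (ω [ ω' ]) ≡ inv ω [ inv ω' ]
inv-[] ω ω' = inv-subIso (single-InvertsTo ω') ω

mainTheorem8 : (ω ω' : Iso) → ω ⟶ ω' → inv ω ⟶ inv ω'
mainTheorem8 (fix ω) _ fix-unfold =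
  subst (fix (inv ω) ⟶_) (sym (inv-[] ω (fix ω))) fix-unfold
mainTheorem8 (app (lam ω₁) ω₂) _ beta =
  subst (app (lam (inv ω₁)) (inv ω₂) ⟶_) (sym (inv-[] ω₁ ω₂)) beta
mainTheorem8 (app ω₁ ω₂) (app ω₁' .ω₂) (app-left r) =
  app-left (mainTheorem8 ω₁ ω₁' r)
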